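{- Let $p>2$ be a prime, $n\ge1$, and let $M_1,\dots,M_n$ be symmetric $n\times n$ matrices over $\mathbb{F}_p$ such that every nonzero $\mathbb{F}_p$-linear combination of them has rank $n$; put $Q_t(x)=x^TM_tx$ and $A=\mathrm{QGS}(p,n)=\{x\in\mathbb{F}_p^n : \exists i \text{ with } Q_1(x)=\dots=Q_{i-1}(x)=0,\ Q_i(x)=1\}$. Fix integers $k\ge3$ and $m\in[n]$, and let $x_0=y_0=0$ and $x_1,\dots,x_k,y_1,\dots,y_k\in\mathbb{F}_p^n$, with $X=\{x_0,x_1,\dots,x_k\}$ and $Y=\{y_0,y_1,\dots,y_k\}$. For $t\in[n]$ and $(i,j)\in[0,k]^2$ write $\mu^{(t)}_{i,j}=2x_i^TM_ty_j$. Suppose that $\mu^{(t)}_{i,j}=0$ for all $t<m$ and all $(i,j)\in[0,k]^2$. If $(X,Y)$ is quadratically shattered by $A$, then $\mu^{(m)}_{i,j}\in\{ -2,-1,0,1,2\}\subseteq\mathbb{F}_p$ for every $(i,j)\in[k]^2$.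
   Context: Here $[0,k]=\{0,1,\dots,k\}$ and $[k]=\{1,\dots,k\}$. A containment map on $[0,k]^2$ is a function $\phi:[0,k]^2\to\{A,A^C\}$; an element $z\in\mathbb{F}_p^n$ realises $\phi$ if $x_i+y_j+z\in\phi(i,j)$ for all $(i,j)\in[0,k]^2$. The pair $(X,Y)$ is quadratically shattered by $A$ if every containment map on $[0,k]^2$ is realised by some $z\in\mathbb{F}_p^n$. -}

module Defs where

open import Data.Nat using (ℕ; zero; suc; _+_; _*_; _∸_; NonZero)
open import Data.Nat.DivMod using (_mod_)
open import Data.Fin using (Fin; toℕ; _<_)
import Data.Fin as F
open import Data.Bool using (Bool; true; false)
open import Data.Product using (Σ; _×_; ∃)
open import Relation.Nullary using (¬_)
open import Relation.Binary.PropositionalEquality using (_≡_)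

Fp : ℕ → Set
Fp p = Fin p

module _ {p : ℕ} .{{_ : NonZero p}} where

  ι : ℕ → Fp p
  ι a = a mod p

  0F 1F : Fp p
  0F = ι 0
  1F = ι 1

  infixl 6 _+F_
  infixl 7 _*F_

  _+F_ : Fp p → Fp p → Fp p
  a +F b = ι (toℕ a + toℕ b)

  _*F_ : Fp p → Fp p → Fp p
  a *F b = ι (toℕ a * toℕ b)

  -F_ : Fp p → Fp p
  -F a = ι (p ∸ toℕ a)

  ΣF : ∀ {n} → (Fin n → Fp p) → Fp p
  ΣF {zero}  f = 0F
  ΣF {suc n} f = f F.zero +F ΣF (λ i → f (F.suc i))

  Vec : ℕ → Set
  Vec n = Fin n → Fp p

  Mat : ℕ → Set
  Mat n = Fin n → Fin n → Fp p

  0V : ∀ {n} → Vec n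
  0V _ = 0F

  _+V_ : ∀ {n} → Vec n → Vec n → Vec n
  (u +V v) l = u l +F v l

  Symmetric : ∀ {n} → Mat n → Set
  Symmetric N = ∀ i j → N i j ≡ N j i

  HasRankN : ∀ {n} → Mat n → Set
  HasRankN {n} N =
    (c : Vec n) → (∀ i → ΣF (λ j → N i j *F c j) ≡ 0F) → ∀ j → c j ≡ 0F

  LinComb : ∀ {n r} → (Fin r → Fp p) → (Fin r → Mat n) → Mat n
  LinComb c M i j = ΣF (λ t → c t *F M t i j)

  NonZeroVec : ∀ {r} → (Fin r → Fp p) → Set
  NonZeroVec c = ¬ (∀ t → c t ≡ 0F)

  AllCombsFullRank : ∀ {n} → (Fin n → Mat n) → Set
  AllCombsFullRank M = ∀ c → NonZeroVec c → HasRankN (LinComb c M)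

  bil : ∀ {n} → Mat n → Vec n → Vec n → Fp p
  bil N u v = ΣF (λ i → ΣF (λ j → u i *F (N i j *F v j)))

  Q : ∀ {n} → (Fin n → Mat n) → Fin n → Vec n → Fp p
  Q M t x = bil (M t) x x

  InQGS : ∀ {n} → (Fin n → Mat n) → Vec n → Set
  InQGS M x = ∃ λ i → (∀ t → t < i → Q M t x ≡ 0F) × (Q M i x ≡ 1F)

  -- Points x_0 = 0, x_1..x_k, indexed by [0,k] = Fin (suc k)

  withZero : ∀ {n k} → (Fin k → Vec n) → Fin (suc k) → Vec n
  withZero x F.zero    = 0V
  withZero x (F.suc i) = x i

  -- containment maps: true means "∈ A", false means "∈ A^C"
  Contained : Bool → Set → Set
  Contained true  P = P
  Contained false P = ¬ P

  Realises : ∀ {n k} → (A : Vec n → Set) → (X Y : Fin (suc k) → Vec n) →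
             (Fin (suc k) → Fin (suc k) → Bool) → Vec n → Set
  Realises A X Y φ z = ∀ i j → Contained (φ i j) (A ((X i +V Y j) +V z))

  QuadShattered : ∀ {n k} → (A : Vec n → Set) → (X Y : Fin (suc k) → Vec n) → Set
  QuadShattered A X Y = ∀ φ → ∃ λ z → Realises A X Y φ z

  μ : ∀ {n k} → (Fin n → Mat n) → (X Y : Fin (suc k) → Vec n) →
      Fin n → Fin (suc k) → Fin (suc k) → Fp p
  μ M X Y t i j = ι 2 *F bil (M t) (X i) (Y j)

  InSmall : Fp p → Set
  InSmall a = ∃ λ (s : Fin 5) → a ≡ ([ s ])
    where
    [_] : Fin 5 → Fp p
    [ F.zero ] = -F ι 2
    [ F.suc F.zero ] = -F ι 1
    [ F.suc (F.suc F.zero) ] = ι 0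
    [ F.suc (F.suc (F.suc F.zero)) ] = ι 1
    [ F.suc (F.suc (F.suc (F.suc F.zero))) ] = ι 2

module Submission where

open import Defs
open import Data.Nat using (ℕ; suc; _≤_; _<_; NonZero)
open import Data.Nat.Primality using (Prime)
open import Data.Fin using (Fin)
import Data.Fin as F
open import Relation.Binary.PropositionalEquality using (_≡_)

open import Level using (0ℓ)
open import Data.Nat using (zero; _+_; _*_; _∸_; _%_; _≟_; _≤?_; z≤n; s≤s)
open import Data.Nat.Properties
  using (+-comm; +-assoc; *-comm; *-assoc; *-distribˡ-+; m+[n∸m]≡n; m∸n≤m; m<n⇒0<n∸m; +-mono-≤;
         <⇒≤; ≤-pred; ≰⇒>; ≤-trans; <-trans; <-≤-trans; ≤-<-trans)
open import Data.Nat.DivMod using (m%n<n; m<n⇒m%n≡m; %-distribˡ-+; %-distribˡ-*; [m+n]%n≡m%n)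
open import Data.Fin using (toℕ; inject≤)
import Data.Fin.Patterns as Fin
open import Data.Fin.Properties using (toℕ-fromℕ<; toℕ-injective; toℕ<n; inject≤-injective; any?; all?)
import Data.Fin.Properties as FinP
open import Data.Fin.Induction using (<-wellFounded)
open import Data.Fin.Permutation using (transpose; _⟨$⟩ʳ_)
import Data.Vec as V
open import Data.Bool using (Bool; true; false; T; not)
open import Data.Product using (Σ-syntax; _×_; _,_; proj₁; proj₂)
open import Data.Sum using (_⊎_; inj₁; inj₂)
open import Function using (_∘_)
open import Function.Bundles using (Injection)
open import Function.Definitions using (Injective)
open import Function.Properties.Inverse using (↔⇒↣)
open import Induction.WellFounded using (module All)
open import Algebra.Bundles using (AbelianGroup)
import Algebra.Properties.AbelianGroup as AbelianGroupProperties
import Algebra.Properties.CommutativeSemigroup as CommutativeSemigroupProperties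
import Algebra.Solver.CommutativeMonoid as CommutativeMonoidSolver
open import Relation.Nullary using (¬_; yes; no; contradiction)
open import Relation.Nullary.Decidable using (from-yes; ¬?; _→-dec_; _×-dec_)
open import Relation.Binary.Definitions using (tri<; tri≈; tri>)
open import Relation.Binary.PropositionalEquality
  using (_≢_; refl; sym; trans; cong; cong₂; subst; module ≡-Reasoning)
open import Relation.Binary.PropositionalEquality.Algebra using (isMagma)
open ≡-Reasoning

-- Fix i, j and pick u, v ≠ i and u′, v′ ≠ j (possible as k ≥ 3); let z realise on the
-- grid of points x_r + y_c + z (rows r ∈ {0,i,u,v}, columns c ∈ {0,j,u′,v′}) the containment
-- map `shape`. For symmetric M_t the values Q_t(x_r + y_c + z) satisfy the rectangle
-- identity Q(r,c) + Q(r′,c′) − Q(r,c′) − Q(r′,c) = μ(r,c) + μ(r′,c′) − μ(r,c′) − μ(r′,c).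
-- By induction on t < m, where μ⁽ᵗ⁾ = 0, every lower form vanishes on the grid, so Q_t is
-- additive there, lies in {0,1} on the cells in A and avoids 1 on the cells outside A;
-- a finite check shows that this forces Q_t = 0 on the grid. At level m the cells (0,0),
-- (0,j), (i,0), (i,j) lie in A, so their Q_m-values are bits, and since x₀ = y₀ = 0 the
-- rectangle identity reads μ⁽ᵐ⁾_{i,j} = Q(i,j) + Q(0,0) − Q(i,0) − Q(0,j) ∈ {−2,…,2}.

-- Arithmetic of F_p

module _ {p : ℕ} .{{_ : NonZero p}} where

  toℕ-ι : ∀ m → toℕ (ι {p} m) ≡ m % p
  toℕ-ι m = toℕ-fromℕ< (m%n<n m p)

  ι-toℕ : ∀ (a : Fp p) → ι (toℕ a) ≡ a
  ι-toℕ a = toℕ-injective (trans (toℕ-ι (toℕ a)) (m<n⇒m%n≡m (toℕ<n a)))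

  ι-+ : ∀ m n → ι {p} m +F ι n ≡ ι (m + n)
  ι-+ m n = toℕ-injective (begin
    toℕ (ι {p} (toℕ (ι {p} m) + toℕ (ι {p} n))) ≡⟨ toℕ-ι _ ⟩
    (toℕ (ι {p} m) + toℕ (ι {p} n)) % p         ≡⟨ cong₂ (λ a b → (a + b) % p) (toℕ-ι m) (toℕ-ι n) ⟩
    (m % p + n % p) % p                         ≡⟨ %-distribˡ-+ m n p ⟨
    (m + n) % p                                 ≡⟨ toℕ-ι (m + n) ⟨
    toℕ (ι {p} (m + n))                         ∎)

  ι-* : ∀ m n → ι {p} m *F ι n ≡ ι (m * n)
  ι-* m n = toℕ-injective (begin
    toℕ (ι {p} (toℕ (ι {p} m) * toℕ (ι {p} n))) ≡⟨ toℕ-ι _ ⟩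
    (toℕ (ι {p} m) * toℕ (ι {p} n)) % p         ≡⟨ cong₂ (λ a b → (a * b) % p) (toℕ-ι m) (toℕ-ι n) ⟩
    (m % p * (n % p)) % p                       ≡⟨ %-distribˡ-* m n p ⟨
    (m * n) % p                                 ≡⟨ toℕ-ι (m * n) ⟨
    toℕ (ι {p} (m * n))                         ∎)

  ι-injective-< : ∀ {m n} → m < p → n < p → ι {p} m ≡ ι n → m ≡ n
  ι-injective-< {m} {n} m<p n<p eq = begin
    m           ≡⟨ m<n⇒m%n≡m m<p ⟨
    m % p       ≡⟨ toℕ-ι m ⟨
    toℕ (ι {p} m) ≡⟨ cong toℕ eq ⟩
    toℕ (ι {p} n) ≡⟨ toℕ-ι n ⟩
    n % p       ≡⟨ m<n⇒m%n≡m n<p ⟩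
    n           ∎

  +F-comm : ∀ (a b : Fp p) → a +F b ≡ b +F a
  +F-comm a b = cong ι (+-comm (toℕ a) (toℕ b))

  *F-comm : ∀ (a b : Fp p) → a *F b ≡ b *F a
  *F-comm a b = cong ι (*-comm (toℕ a) (toℕ b))

  +F-assoc : ∀ (a b c : Fp p) → (a +F b) +F c ≡ a +F (b +F c)
  +F-assoc a b c = begin
    (a +F b) +F c                  ≡⟨ cong ((a +F b) +F_) (ι-toℕ c) ⟨
    ι (toℕ a + toℕ b) +F ι (toℕ c) ≡⟨ ι-+ _ _ ⟩
    ι (toℕ a + toℕ b + toℕ c)      ≡⟨ cong ι (+-assoc (toℕ a) _ _) ⟩
    ι (toℕ a + (toℕ b + toℕ c))    ≡⟨ ι-+ _ _ ⟨
    ι (toℕ a) +F (b +F c)          ≡⟨ cong (_+F (b +F c)) (ι-toℕ a) ⟩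
    a +F (b +F c)                  ∎

  *F-assoc : ∀ (a b c : Fp p) → (a *F b) *F c ≡ a *F (b *F c)
  *F-assoc a b c = begin
    (a *F b) *F c                  ≡⟨ cong ((a *F b) *F_) (ι-toℕ c) ⟨
    ι (toℕ a * toℕ b) *F ι (toℕ c) ≡⟨ ι-* _ _ ⟩
    ι (toℕ a * toℕ b * toℕ c)      ≡⟨ cong ι (*-assoc (toℕ a) _ _) ⟩
    ι (toℕ a * (toℕ b * toℕ c))    ≡⟨ ι-* _ _ ⟨
    ι (toℕ a) *F (b *F c)          ≡⟨ cong (_*F (b *F c)) (ι-toℕ a) ⟩
    a *F (b *F c)                  ∎

  *F-distribˡ : ∀ (a b c : Fp p) → a *F (b +F c) ≡ a *F b +F a *F c
  *F-distribˡ a b c = begin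
    a *F (b +F c)                      ≡⟨ cong (_*F (b +F c)) (ι-toℕ a) ⟨
    ι (toℕ a) *F ι (toℕ b + toℕ c)     ≡⟨ ι-* _ _ ⟩
    ι (toℕ a * (toℕ b + toℕ c))        ≡⟨ cong ι (*-distribˡ-+ (toℕ a) (toℕ b) _) ⟩
    ι (toℕ a * toℕ b + toℕ a * toℕ c)  ≡⟨ ι-+ _ _ ⟨
    a *F b +F a *F c                   ∎

  *F-distribʳ : ∀ (a b c : Fp p) → (b +F c) *F a ≡ b *F a +F c *F a
  *F-distribʳ a b c = begin
    (b +F c) *F a     ≡⟨ *F-comm (b +F c) a ⟩
    a *F (b +F c)     ≡⟨ *F-distribˡ a b c ⟩
    a *F b +F a *F c  ≡⟨ cong₂ _+F_ (*F-comm a b) (*F-comm a c) ⟩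
    b *F a +F c *F a  ∎

  *F-zeroˡ : ∀ (a : Fp p) → 0F *F a ≡ 0F
  *F-zeroˡ a = trans (cong (0F *F_) (sym (ι-toℕ a))) (ι-* 0 (toℕ a))

  *F-zeroʳ : ∀ (a : Fp p) → a *F 0F ≡ 0F
  *F-zeroʳ a = trans (*F-comm a 0F) (*F-zeroˡ a)

  +F-identityˡ : ∀ (a : Fp p) → 0F +F a ≡ a
  +F-identityˡ a = trans (cong (0F +F_) (sym (ι-toℕ a))) (trans (ι-+ 0 (toℕ a)) (ι-toℕ a))

  +F-identityʳ : ∀ (a : Fp p) → a +F 0F ≡ a
  +F-identityʳ a = trans (+F-comm a 0F) (+F-identityˡ a)

  -F-inverseʳ : ∀ (a : Fp p) → a +F -F a ≡ 0F
  -F-inverseʳ a = begin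
    a +F -F a                    ≡⟨ cong (_+F -F a) (ι-toℕ a) ⟨
    ι (toℕ a) +F ι (p ∸ toℕ a)   ≡⟨ ι-+ _ _ ⟩
    ι (toℕ a + (p ∸ toℕ a))      ≡⟨ cong ι (m+[n∸m]≡n (<⇒≤ (toℕ<n a))) ⟩
    ι p                          ≡⟨ toℕ-injective (trans (toℕ-ι p) (trans ([m+n]%n≡m%n 0 p) (sym (toℕ-ι 0)))) ⟩
    0F                           ∎

  *F-two : ∀ (a : Fp p) → ι 2 *F a ≡ a +F a
  *F-two a = begin
    ι 2 *F a                 ≡⟨ cong (ι 2 *F_) (ι-toℕ a) ⟨
    ι 2 *F ι (toℕ a)         ≡⟨ ι-* 2 (toℕ a) ⟩
    ι (2 * toℕ a)            ≡⟨ cong ι (cong (toℕ a +_) (+-comm (toℕ a) 0)) ⟩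
    ι (toℕ a + toℕ a)        ≡⟨ ι-+ _ _ ⟨
    ι (toℕ a) +F ι (toℕ a)   ≡⟨ cong₂ _+F_ (ι-toℕ a) (ι-toℕ a) ⟩
    a +F a                   ∎

  +F-abelianGroup : AbelianGroup 0ℓ 0ℓ
  +F-abelianGroup = record
    { Carrier = Fp p ; _≈_ = _≡_ ; _∙_ = _+F_ ; ε = 0F ; _⁻¹ = -F_
    ; isAbelianGroup = record
      { isGroup = record
        { isMonoid = record
          { isSemigroup = record { isMagma = isMagma _+F_ ; assoc = +F-assoc }
          ; identity = +F-identityˡ , +F-identityʳ }
        ; inverse = (λ a → trans (+F-comm (-F a) a) (-F-inverseʳ a)) , -F-inverseʳ
        ; ⁻¹-cong = cong -F_ }
      ; comm = +F-comm } }

  open AbelianGroupProperties +F-abelianGroup using (∙-cancelˡ; ∙-cancelʳ; inverseʳ-unique)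
  open CommutativeSemigroupProperties (AbelianGroup.commutativeSemigroup +F-abelianGroup)
    using (interchange)
  module +F-Solver = CommutativeMonoidSolver (AbelianGroup.commutativeMonoid +F-abelianGroup)

  InSmall-ι : ∀ {d} → d ≤ 2 → InSmall (ι {p} d)
  InSmall-ι {0} _ = Fin.2F , refl
  InSmall-ι {1} _ = Fin.3F , refl
  InSmall-ι {2} _ = Fin.4F , refl
  InSmall-ι {suc (suc (suc _))} (s≤s (s≤s ()))

  InSmall-negι : ∀ {d} → 0 < d → d ≤ 2 → InSmall (-F ι {p} d)
  InSmall-negι {1} _ _ = Fin.1F , refl
  InSmall-negι {2} _ _ = Fin.0F , refl
  InSmall-negι {suc (suc (suc _))} _ (s≤s (s≤s ()))

  small-difference : ∀ {L R} {a : Fp p} → L ≤ 2 → R ≤ 2 → ι L ≡ ι R +F a → InSmall a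
  small-difference {L} {R} {a} L≤2 R≤2 eq with R ≤? L
  ... | yes R≤L = subst InSmall (sym a≡L∸R) (InSmall-ι (≤-trans (m∸n≤m L R) L≤2))
    where
    a≡L∸R : a ≡ ι (L ∸ R)
    a≡L∸R = ∙-cancelˡ (ι R) a _ (begin
      ι R +F a           ≡⟨ eq ⟨
      ι L                ≡⟨ cong ι (m+[n∸m]≡n R≤L) ⟨
      ι (R + (L ∸ R))    ≡⟨ ι-+ R (L ∸ R) ⟨
      ι R +F ι (L ∸ R)   ∎)
  ... | no R≰L = subst InSmall (sym a≡-R∸L) (InSmall-negι (m<n⇒0<n∸m L<R) (≤-trans (m∸n≤m R L) R≤2))
    where
    L<R : L < R
    L<R = ≰⇒> R≰L
    a≡-R∸L : a ≡ -F ι (R ∸ L)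
    a≡-R∸L = inverseʳ-unique (ι (R ∸ L)) a (∙-cancelˡ (ι L) _ _ (begin
      ι L +F (ι (R ∸ L) +F a)   ≡⟨ +F-assoc (ι L) _ a ⟨
      (ι L +F ι (R ∸ L)) +F a   ≡⟨ cong (_+F a) (trans (ι-+ L (R ∸ L)) (cong ι (m+[n∸m]≡n (<⇒≤ L<R)))) ⟩
      ι R +F a                  ≡⟨ eq ⟨
      ι L                       ≡⟨ +F-identityʳ (ι L) ⟨
      ι L +F 0F                 ∎))

  0F≢1F : 1 < p → 0F {p} ≢ 1F
  0F≢1F 1<p eq with ι-injective-< (<-≤-trans (s≤s z≤n) 1<p) 1<p eq
  ... | ()

-- Sums, bilinear forms and the rectangle identity

  ΣF-cong : ∀ {n} {f g : Fin n → Fp p} → (∀ i → f i ≡ g i) → ΣF f ≡ ΣF g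
  ΣF-cong {zero}  f≗g = refl
  ΣF-cong {suc n} f≗g = cong₂ _+F_ (f≗g F.zero) (ΣF-cong (f≗g ∘ F.suc))

  ΣF-0 : ∀ n → ΣF {p} {n} (λ _ → 0F) ≡ 0F
  ΣF-0 zero    = refl
  ΣF-0 (suc n) = trans (cong (0F +F_) (ΣF-0 n)) (+F-identityˡ 0F)

  ΣF-+ : ∀ {n} (f g : Fin n → Fp p) → ΣF (λ i → f i +F g i) ≡ ΣF f +F ΣF g
  ΣF-+ {zero}  f g = sym (+F-identityˡ 0F)
  ΣF-+ {suc n} f g = trans (cong ((f F.zero +F g F.zero) +F_) (ΣF-+ (f ∘ F.suc) (g ∘ F.suc)))
                           (interchange (f F.zero) (g F.zero) _ _)

  ΣF-comm : ∀ {n m} (h : Fin n → Fin m → Fp p) →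
            ΣF (λ i → ΣF (λ j → h i j)) ≡ ΣF (λ j → ΣF (λ i → h i j))
  ΣF-comm {zero}  {m} h = sym (ΣF-0 m)
  ΣF-comm {suc n} {m} h = trans (cong (ΣF (h F.zero) +F_) (ΣF-comm (h ∘ F.suc)))
                                (sym (ΣF-+ (h F.zero) _))

  module _ {n : ℕ} (N : Mat {p} n) where

    bil-+ˡ : ∀ (u v w : Vec {p} n) → bil N (u +V v) w ≡ bil N u w +F bil N v w
    bil-+ˡ u v w = trans (ΣF-cong {n} λ i → trans (ΣF-cong {n} λ j → *F-distribʳ _ (u i) (v i)) (ΣF-+ {n} _ _))
                         (ΣF-+ {n} _ _)

    bil-+ʳ : ∀ (u v w : Vec {p} n) → bil N u (v +V w) ≡ bil N u v +F bil N u w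
    bil-+ʳ u v w = trans (ΣF-cong {n} λ i → trans (ΣF-cong {n} λ j →
                     trans (cong (u i *F_) (*F-distribˡ (N i j) (v j) (w j))) (*F-distribˡ (u i) _ _))
                     (ΣF-+ {n} _ _))
                   (ΣF-+ {n} _ _)

    bil-0ˡ : ∀ (v : Vec {p} n) → bil N 0V v ≡ 0F
    bil-0ˡ v = trans (ΣF-cong {n} λ i → trans (ΣF-cong {n} λ j → *F-zeroˡ _) (ΣF-0 n)) (ΣF-0 n)

    bil-sym : Symmetric N → ∀ (u v : Vec {p} n) → bil N u v ≡ bil N v u
    bil-sym N-sym u v = trans (ΣF-comm {n} {n} _) (ΣF-cong {n} λ j → ΣF-cong {n} λ i → begin
      u i *F (N i j *F v j)   ≡⟨ *F-comm (u i) _ ⟩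
      (N i j *F v j) *F u i   ≡⟨ cong (λ a → (a *F v j) *F u i) (N-sym i j) ⟩
      (N j i *F v j) *F u i   ≡⟨ cong (_*F u i) (*F-comm (N j i) (v j)) ⟩
      (v j *F N j i) *F u i   ≡⟨ *F-assoc (v j) _ _ ⟩
      v j *F (N j i *F u i)   ∎)

  separable-rectangle : ∀ {A B : Set} (f β : A → B → Fp p) (g : A → Fp p) (h : B → Fp p) →
    (∀ x y → f x y ≡ (g x +F h y) +F β x y) →
    ∀ x x' y y' → (f x y +F f x' y') +F (β x y' +F β x' y) ≡ (f x y' +F f x' y) +F (β x y +F β x' y')
  separable-rectangle f β g h f≡ x x' y y' = begin
    (f x y +F f x' y') +F (β x y' +F β x' y)
      ≡⟨ cong₂ (λ s t → (s +F t) +F (β x y' +F β x' y)) (f≡ x y) (f≡ x' y') ⟩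
    (((g x +F h y) +F β x y) +F ((g x' +F h y') +F β x' y')) +F (β x y' +F β x' y)
      ≡⟨ solve 8 (λ gx gx' hy hy' bxy bxy' bx'y bx'y' →
           (((gx ⊕ hy) ⊕ bxy) ⊕ ((gx' ⊕ hy') ⊕ bx'y')) ⊕ (bxy' ⊕ bx'y) ⊜
           (((gx ⊕ hy') ⊕ bxy') ⊕ ((gx' ⊕ hy) ⊕ bx'y)) ⊕ (bxy ⊕ bx'y'))
           refl (g x) (g x') (h y) (h y') (β x y) (β x y') (β x' y) (β x' y') ⟩
    (((g x +F h y') +F β x y') +F ((g x' +F h y) +F β x' y)) +F (β x y +F β x' y')
      ≡⟨ cong₂ (λ s t → (s +F t) +F (β x y +F β x' y')) (f≡ x y') (f≡ x' y) ⟨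
    (f x y' +F f x' y) +F (β x y +F β x' y') ∎
    where open +F-Solver

  module _ {n : ℕ} (N : Mat {p} n) (N-sym : Symmetric N) where

    private
      q : Vec {p} n → Fp p
      q u = bil N u u

      β : Vec {p} n → Vec {p} n → Fp p
      β u v = ι 2 *F bil N u v

    bil-0ʳ : ∀ (u : Vec {p} n) → bil N u 0V ≡ 0F
    bil-0ʳ u = trans (bil-sym N N-sym u 0V) (bil-0ˡ N u)

    quadratic-+ : ∀ (a b : Vec {p} n) → q (a +V b) ≡ (q a +F q b) +F β a b
    quadratic-+ a b = begin
      q (a +V b)                                           ≡⟨ bil-+ˡ N a b (a +V b) ⟩
      bil N a (a +V b) +F bil N b (a +V b)                 ≡⟨ cong₂ _+F_ (bil-+ʳ N a a b) (bil-+ʳ N b a b) ⟩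
      (q a +F bil N a b) +F (bil N b a +F q b)             ≡⟨ cong (λ t → (q a +F bil N a b) +F (t +F q b)) (bil-sym N N-sym b a) ⟩
      (q a +F bil N a b) +F (bil N a b +F q b)             ≡⟨ solve 3 (λ A B C → (A ⊕ B) ⊕ (B ⊕ C) ⊜ (A ⊕ C) ⊕ (B ⊕ B)) refl (q a) (bil N a b) (q b) ⟩
      (q a +F q b) +F (bil N a b +F bil N a b)             ≡⟨ cong ((q a +F q b) +F_) (*F-two (bil N a b)) ⟨
      (q a +F q b) +F β a b                                ∎
      where open +F-Solver

    quadratic-rectangle : ∀ z x x' y y' →
      (q ((x +V y) +V z) +F q ((x' +V y') +V z)) +F (β x y' +F β x' y) ≡
      (q ((x +V y') +V z) +F q ((x' +V y) +V z)) +F (β x y +F β x' y')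
    quadratic-rectangle z = separable-rectangle (λ x y → q ((x +V y) +V z)) β
      (λ x → q x +F β x z) (λ y → (q y +F q z) +F β y z) expand
      where
      open +F-Solver
      expand : ∀ x y → q ((x +V y) +V z) ≡ ((q x +F β x z) +F ((q y +F q z) +F β y z)) +F β x y
      expand x y = begin
        q ((x +V y) +V z)                                    ≡⟨ quadratic-+ (x +V y) z ⟩
        (q (x +V y) +F q z) +F β (x +V y) z                  ≡⟨ cong₂ (λ s t → (s +F q z) +F t) (quadratic-+ x y)
                                                                  (trans (cong (ι 2 *F_) (bil-+ˡ N x y z)) (*F-distribˡ (ι 2) _ _)) ⟩
        (((q x +F q y) +F β x y) +F q z) +F (β x z +F β y z) ≡⟨ solve 6 (λ qx qy qz bxy bxz byz →
                                                                  (((qx ⊕ qy) ⊕ bxy) ⊕ qz) ⊕ (bxz ⊕ byz) ⊜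
                                                                  ((qx ⊕ bxz) ⊕ ((qy ⊕ qz) ⊕ byz)) ⊕ bxy)
                                                                  refl (q x) (q y) (q z) (β x y) (β x z) (β y z) ⟩
        ((q x +F β x z) +F ((q y +F q z) +F β y z)) +F β x y ∎

  InQGS⇒Q≡0⊎Q≡1 : ∀ {n} {M : Fin n → Mat {p} n} {w : Vec {p} n} {t : Fin n} → 1 < p →
    InQGS M w → (∀ s → s F.< t → Q M s w ≡ 0F) → Q M t w ≡ 0F ⊎ Q M t w ≡ 1F
  InQGS⇒Q≡0⊎Q≡1 {t = t} 1<p (s , below-s , Qs≡1) below-t with FinP.<-cmp s t
  ... | tri< s<t _ _ = contradiction (trans (sym (below-t s s<t)) Qs≡1) (0F≢1F 1<p)
  ... | tri≈ _ refl _ = inj₂ Qs≡1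
  ... | tri> _ _ t<s = inj₁ (below-s t t<s)

-- Bits and the 4 × 4 grid

  Bit : Fp p → Set
  Bit a = Σ[ b ∈ Fin 2 ] a ≡ ι (toℕ b)

  bit : ∀ {a : Fp p} → a ≡ 0F ⊎ a ≡ 1F → Bit a
  bit (inj₁ a≡0) = Fin.0F , a≡0
  bit (inj₂ a≡1) = Fin.1F , a≡1

  ⟦_⟧ : ∀ {a : Fp p} → Bit a → ℕ
  ⟦ x ⟧ = toℕ (proj₁ x)

  bit-+ : ∀ {a a′ : Fp p} (x : Bit a) (y : Bit a′) → a +F a′ ≡ ι (⟦ x ⟧ + ⟦ y ⟧)
  bit-+ (b , a≡b) (b′ , a′≡b′) = trans (cong₂ _+F_ a≡b a′≡b′) (ι-+ (toℕ b) (toℕ b′))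

  bit-+-≤2 : ∀ {a a′ : Fp p} (x : Bit a) (y : Bit a′) → ⟦ x ⟧ + ⟦ y ⟧ ≤ 2
  bit-+-≤2 (b , _) (b′ , _) = +-mono-≤ (≤-pred (toℕ<n b)) (≤-pred (toℕ<n b′))

  bit-zero : ∀ {a : Fp p} (x : Bit a) → ⟦ x ⟧ ≡ 0 → a ≡ 0F
  bit-zero (b , a≡b) b≡0 = trans a≡b (cong ι b≡0)

  Additive : ∀ {a b} → (Fin a → Fin b → Fp p) → Set
  Additive w = ∀ r r′ c c′ → w r c +F w r′ c′ ≡ w r c′ +F w r′ c

  corner-sum : 2 < p → ∀ {a₁ a₂ a₃ a₄ : Fp p} (x₁ : Bit a₁) (x₂ : Bit a₂) (x₃ : Bit a₃) (x₄ : Bit a₄) →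
    a₁ +F a₂ ≡ a₃ +F a₄ → ⟦ x₁ ⟧ + ⟦ x₂ ⟧ ≡ ⟦ x₃ ⟧ + ⟦ x₄ ⟧
  corner-sum p>2 x₁ x₂ x₃ x₄ eq =
    ι-injective-< (≤-<-trans (bit-+-≤2 x₁ x₂) p>2) (≤-<-trans (bit-+-≤2 x₃ x₄) p>2)
      (trans (sym (bit-+ x₁ x₂)) (trans eq (bit-+ x₃ x₄)))

  fourth-corner-≢1 : ∀ {a a₂ a₃ a₄ : Fp p} → a ≢ 1F → (x₂ : Bit a₂) (x₃ : Bit a₃) (x₄ : Bit a₄) →
    a +F a₂ ≡ a₃ +F a₄ → 1 + ⟦ x₂ ⟧ ≢ ⟦ x₃ ⟧ + ⟦ x₄ ⟧
  fourth-corner-≢1 {a} {a₂} a≢1 x₂ x₃ x₄ eq sums≡ = a≢1 (∙-cancelʳ a₂ a 1F (begin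
    a +F a₂                   ≡⟨ eq ⟩
    _                         ≡⟨ bit-+ x₃ x₄ ⟩
    ι (⟦ x₃ ⟧ + ⟦ x₄ ⟧)       ≡⟨ cong ι sums≡ ⟨
    ι (1 + ⟦ x₂ ⟧)            ≡⟨ ι-+ 1 ⟦ x₂ ⟧ ⟨
    1F +F ι ⟦ x₂ ⟧            ≡⟨ cong (1F +F_) (proj₂ x₂) ⟨
    1F +F a₂                  ∎))

  fourth-corner-zero : ∀ {a a₂ a₃ a₄ : Fp p} → a₂ ≡ 0F → a₃ ≡ 0F → a₄ ≡ 0F →
    a +F a₂ ≡ a₃ +F a₄ → a ≡ 0F
  fourth-corner-zero {a} refl refl refl eq = ∙-cancelʳ 0F a 0F eq

  +F-drop-zeros : ∀ {a b c u v w : Fp p} → u ≡ 0F → v ≡ 0F → w ≡ 0F →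
    a +F (u +F v) ≡ b +F (c +F w) → a ≡ b +F c
  +F-drop-zeros {a} {b} {c} refl refl refl eq = begin
    a                    ≡⟨ +F-identityʳ a ⟨
    a +F 0F              ≡⟨ cong (a +F_) (+F-identityˡ 0F) ⟨
    a +F (0F +F 0F)      ≡⟨ eq ⟩
    b +F (c +F 0F)       ≡⟨ cong (b +F_) (+F-identityʳ c) ⟩
    b +F c               ∎

-- The containment map put on the grid: rows x₀, xᵢ, x_u, x_v, columns y₀, y_j, y_u′, y_v′,
-- and true meaning membership in A.
shape : Fin 4 → Fin 4 → Bool
shape r c = V.lookup (V.lookup rows r) c
  where
  rows : V.Vec (V.Vec Bool 4) 4
  rows = (true  V.∷ true  V.∷ false V.∷ false V.∷ V.[]) V.∷
         (true  V.∷ true  V.∷ false V.∷ true  V.∷ V.[]) V.∷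
         (false V.∷ false V.∷ false V.∷ true  V.∷ V.[]) V.∷
         (false V.∷ true  V.∷ true  V.∷ true  V.∷ V.[]) V.∷ V.[]

-- w_rc is the bit at the true cell (r, c) of `shape`. The hypotheses are the rectangle
-- relations among true cells and, for each false cell, "≠ 1" transported along a rectangle
-- whose other three corners are true; all 2⁹ assignments are checked by evaluation.
shape-bits-vanish :
  ∀ (w₀₀ w₀₁ w₁₀ w₁₁ w₁₃ w₂₃ w₃₁ w₃₂ w₃₃ : Fin 2) →
  toℕ w₀₀ + toℕ w₁₁ ≡ toℕ w₀₁ + toℕ w₁₀ →
  toℕ w₁₁ + toℕ w₃₃ ≡ toℕ w₁₃ + toℕ w₃₁ →
  1 + toℕ w₃₁ ≢ toℕ w₀₁ + toℕ w₃₂ →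
  1 + toℕ w₁₁ ≢ toℕ w₀₁ + toℕ w₁₃ →
  1 + toℕ w₃₃ ≢ toℕ w₁₃ + toℕ w₃₂ →
  1 + toℕ w₁₃ ≢ toℕ w₂₃ + toℕ w₁₀ →
  1 + toℕ w₃₃ ≢ toℕ w₂₃ + toℕ w₃₁ →
  1 + toℕ w₃₃ ≢ toℕ w₂₃ + toℕ w₃₂ →
  1 + toℕ w₁₁ ≢ toℕ w₃₁ + toℕ w₁₀ →
  toℕ w₀₀ ≡ 0 × toℕ w₀₁ ≡ 0 × toℕ w₁₀ ≡ 0 × toℕ w₁₁ ≡ 0 × toℕ w₁₃ ≡ 0 ×
  toℕ w₂₃ ≡ 0 × toℕ w₃₁ ≡ 0 × toℕ w₃₂ ≡ 0 × toℕ w₃₃ ≡ 0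
shape-bits-vanish = from-yes (
  all? λ (w₀₀ : Fin 2) → all? λ (w₀₁ : Fin 2) → all? λ (w₁₀ : Fin 2) →
  all? λ (w₁₁ : Fin 2) → all? λ (w₁₃ : Fin 2) → all? λ (w₂₃ : Fin 2) →
  all? λ (w₃₁ : Fin 2) → all? λ (w₃₂ : Fin 2) → all? λ (w₃₃ : Fin 2) →
  (toℕ w₀₀ + toℕ w₁₁ ≟ toℕ w₀₁ + toℕ w₁₀) →-dec
  (toℕ w₁₁ + toℕ w₃₃ ≟ toℕ w₁₃ + toℕ w₃₁) →-dec
  ¬? (1 + toℕ w₃₁ ≟ toℕ w₀₁ + toℕ w₃₂) →-dec
  ¬? (1 + toℕ w₁₁ ≟ toℕ w₀₁ + toℕ w₁₃) →-dec
  ¬? (1 + toℕ w₃₃ ≟ toℕ w₁₃ + toℕ w₃₂) →-dec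
  ¬? (1 + toℕ w₁₃ ≟ toℕ w₂₃ + toℕ w₁₀) →-dec
  ¬? (1 + toℕ w₃₃ ≟ toℕ w₂₃ + toℕ w₃₁) →-dec
  ¬? (1 + toℕ w₃₃ ≟ toℕ w₂₃ + toℕ w₃₂) →-dec
  ¬? (1 + toℕ w₁₁ ≟ toℕ w₃₁ + toℕ w₁₀) →-dec
  (toℕ w₀₀ ≟ 0) ×-dec (toℕ w₀₁ ≟ 0) ×-dec (toℕ w₁₀ ≟ 0) ×-dec (toℕ w₁₁ ≟ 0) ×-dec (toℕ w₁₃ ≟ 0) ×-dec
  (toℕ w₂₃ ≟ 0) ×-dec (toℕ w₃₁ ≟ 0) ×-dec (toℕ w₃₂ ≟ 0) ×-dec (toℕ w₃₃ ≟ 0))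

module _ {p : ℕ} .{{_ : NonZero p}} where

  grid-vanishes : 2 < p → (w : Fin 4 → Fin 4 → Fp p) → Additive w →
    (∀ r c → T (shape r c) → Bit (w r c)) →
    (∀ r c → T (not (shape r c)) → w r c ≢ 1F) →
    ∀ r c → w r c ≡ 0F
  grid-vanishes p>2 w additive bits ≢1 r c =
    let x₀₀ = bits Fin.0F Fin.0F _ ; x₀₁ = bits Fin.0F Fin.1F _ ; x₁₀ = bits Fin.1F Fin.0F _
        x₁₁ = bits Fin.1F Fin.1F _ ; x₁₃ = bits Fin.1F Fin.3F _ ; x₂₃ = bits Fin.2F Fin.3F _
        x₃₁ = bits Fin.3F Fin.1F _ ; x₃₂ = bits Fin.3F Fin.2F _ ; x₃₃ = bits Fin.3F Fin.3F _
        (_ , z₀₁ , z₁₀ , z₁₁ , _ , z₂₃ , z₃₁ , z₃₂ , z₃₃) = shape-bits-vanish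
          (proj₁ x₀₀) (proj₁ x₀₁) (proj₁ x₁₀) (proj₁ x₁₁) (proj₁ x₁₃)
          (proj₁ x₂₃) (proj₁ x₃₁) (proj₁ x₃₂) (proj₁ x₃₃)
          (corner-sum p>2 x₀₀ x₁₁ x₀₁ x₁₀ (additive Fin.0F Fin.1F Fin.0F Fin.1F))
          (corner-sum p>2 x₁₁ x₃₃ x₁₃ x₃₁ (additive Fin.1F Fin.3F Fin.1F Fin.3F))
          (fourth-corner-≢1 (≢1 Fin.0F Fin.2F _) x₃₁ x₀₁ x₃₂ (additive Fin.0F Fin.3F Fin.2F Fin.1F))
          (fourth-corner-≢1 (≢1 Fin.0F Fin.3F _) x₁₁ x₀₁ x₁₃ (additive Fin.0F Fin.1F Fin.3F Fin.1F))
          (fourth-corner-≢1 (≢1 Fin.1F Fin.2F _) x₃₃ x₁₃ x₃₂ (additive Fin.1F Fin.3F Fin.2F Fin.3F))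
          (fourth-corner-≢1 (≢1 Fin.2F Fin.0F _) x₁₃ x₂₃ x₁₀ (additive Fin.2F Fin.1F Fin.0F Fin.3F))
          (fourth-corner-≢1 (≢1 Fin.2F Fin.1F _) x₃₃ x₂₃ x₃₁ (additive Fin.2F Fin.3F Fin.1F Fin.3F))
          (fourth-corner-≢1 (≢1 Fin.2F Fin.2F _) x₃₃ x₂₃ x₃₂ (additive Fin.2F Fin.3F Fin.2F Fin.3F))
          (fourth-corner-≢1 (≢1 Fin.3F Fin.0F _) x₁₁ x₃₁ x₁₀ (additive Fin.3F Fin.1F Fin.0F Fin.1F))
        row₃ : ∀ c′ → w Fin.3F c′ ≡ 0F
        row₃ = λ { Fin.0F → fourth-corner-zero (bit-zero x₁₁ z₁₁) (bit-zero x₃₁ z₃₁) (bit-zero x₁₀ z₁₀)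
                                                (additive Fin.3F Fin.1F Fin.0F Fin.1F)
                 ; Fin.1F → bit-zero x₃₁ z₃₁
                 ; Fin.2F → bit-zero x₃₂ z₃₂
                 ; Fin.3F → bit-zero x₃₃ z₃₃ }
        col₁ : ∀ r′ → w r′ Fin.1F ≡ 0F
        col₁ = λ { Fin.0F → bit-zero x₀₁ z₀₁
                 ; Fin.1F → bit-zero x₁₁ z₁₁
                 ; Fin.2F → fourth-corner-zero (bit-zero x₃₃ z₃₃) (bit-zero x₂₃ z₂₃) (bit-zero x₃₁ z₃₁)
                                                (additive Fin.2F Fin.3F Fin.1F Fin.3F)
                 ; Fin.3F → bit-zero x₃₁ z₃₁ }
    in fourth-corner-zero (row₃ Fin.1F) (col₁ r) (row₃ c) (additive r Fin.3F c Fin.1F)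

-- Restricting a shattering to a grid

module _ {p : ℕ} .{{_ : NonZero p}} where

  contained-true : ∀ {b : Bool} {P : Set} → Contained {p} b P → T b → P
  contained-true {true} P-holds _ = P-holds

  contained-false : ∀ {b : Bool} {P : Set} → Contained {p} b P → T (not b) → ¬ P
  contained-false {false} ¬P _ = ¬P

retract : ∀ {m n} → (Fin (suc m) → Fin n) → Fin n → Fin (suc m)
retract e y with any? (λ x → e x FinP.≟ y)
... | yes (x , _) = x
... | no _        = F.zero

retract-inverseˡ : ∀ {m n} {e : Fin (suc m) → Fin n} → Injective _≡_ _≡_ e → ∀ x → retract e (e x) ≡ x
retract-inverseˡ {e = e} e-injective x with any? (λ x′ → e x′ FinP.≟ e x)
... | yes (x′ , ex′≡ex) = e-injective ex′≡ex
... | no ∄x′            = contradiction (x , refl) ∄x′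

realises-restriction : ∀ {p} .{{_ : NonZero p}} {n k a b} {A : Vec {p} n → Set}
  {X Y : Fin (suc k) → Vec {p} n} {e : Fin (suc a) → Fin (suc k)} {f : Fin (suc b) → Fin (suc k)} {z : Vec {p} n} →
  Injective _≡_ _≡_ e → Injective _≡_ _≡_ f → (ψ : Fin (suc a) → Fin (suc b) → Bool) →
  Realises A X Y (λ I J → ψ (retract e I) (retract f J)) z →
  ∀ r c → Contained (ψ r c) (A ((X (e r) +V Y (f c)) +V z))
realises-restriction {p} {e = e} {f} e-injective f-injective ψ realises r c =
  subst (λ β → Contained {p} β _) (cong₂ ψ (retract-inverseˡ e-injective r) (retract-inverseˡ f-injective c))
    (realises (e r) (f c))

frame : ∀ {k} → 3 ≤ k → Fin k → Fin 4 → Fin (suc k)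
frame k≥3@(s≤s _) i r = transpose Fin.1F (F.suc i) ⟨$⟩ʳ inject≤ r (s≤s k≥3)

frame-injective : ∀ {k} (k≥3 : 3 ≤ k) (i : Fin k) → Injective _≡_ _≡_ (frame k≥3 i)
frame-injective (s≤s _) i eq = inject≤-injective _ _ _ _ (Injection.injective (↔⇒↣ (transpose _ _)) eq)

frame-0 : ∀ {k} (k≥3 : 3 ≤ k) (i : Fin k) → frame k≥3 i Fin.0F ≡ F.zero
frame-0 (s≤s _) i = refl

frame-1 : ∀ {k} (k≥3 : 3 ≤ k) (i : Fin k) → frame k≥3 i Fin.1F ≡ F.suc i
frame-1 (s≤s _) i = refl

-- The forms Q_t on the grid

module Grid {p : ℕ} .{{_ : NonZero p}} (p>2 : 2 < p) {n k : ℕ}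
  (M : Fin n → Mat {p} n) (M-sym : ∀ t → Symmetric (M t))
  (X Y : Fin (suc k) → Vec {p} n) (row col : Fin 4 → Fin (suc k)) (z : Vec {p} n)
  (realised : ∀ r c → Contained (shape r c) (InQGS M ((X (row r) +V Y (col c)) +V z)))
  where

  cell : Fin 4 → Fin 4 → Vec {p} n
  cell r c = (X (row r) +V Y (col c)) +V z

  Q-at : Fin n → Fin 4 → Fin 4 → Fp p
  Q-at t r c = Q M t (cell r c)

  μ-at : Fin n → Fin 4 → Fin 4 → Fp p
  μ-at t r c = μ M X Y t (row r) (col c)

  Q-at-rectangle : ∀ t r r′ c c′ →
    (Q-at t r c +F Q-at t r′ c′) +F (μ-at t r c′ +F μ-at t r′ c) ≡
    (Q-at t r c′ +F Q-at t r′ c) +F (μ-at t r c +F μ-at t r′ c′)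
  Q-at-rectangle t r r′ c c′ =
    quadratic-rectangle (M t) (M-sym t) z (X (row r)) (X (row r′)) (Y (col c)) (Y (col c′))

  Q-at-additive : ∀ t → (∀ r c → μ-at t r c ≡ 0F) → Additive (Q-at t)
  Q-at-additive t μ≡0 r r′ c c′ = begin
    Q-at t r c +F Q-at t r′ c′                       ≡⟨ +F-drop-zeros (μ≡0 r c′) (μ≡0 r′ c) (μ≡0 r′ c′)
                                                          (Q-at-rectangle t r r′ c c′) ⟩
    (Q-at t r c′ +F Q-at t r′ c) +F μ-at t r c       ≡⟨ cong (Q-at t r c′ +F Q-at t r′ c +F_) (μ≡0 r c) ⟩
    (Q-at t r c′ +F Q-at t r′ c) +F 0F               ≡⟨ +F-identityʳ _ ⟩
    Q-at t r c′ +F Q-at t r′ c                       ∎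

  LevelsVanish : Fin n → Set
  LevelsVanish t = ∀ s → s F.< t → ∀ r c → Q-at s r c ≡ 0F

  level-bit : ∀ {t} → LevelsVanish t → ∀ r c → T (shape r c) → Bit (Q-at t r c)
  level-bit below r c in-A = bit (InQGS⇒Q≡0⊎Q≡1 {M = M} {w = cell r c} (<-trans (s≤s (s≤s z≤n)) p>2)
    (contained-true (realised r c) in-A) (λ s s<t → below s s<t r c))

  level-≢1 : ∀ {t} → LevelsVanish t → ∀ r c → T (not (shape r c)) → Q-at t r c ≢ 1F
  level-≢1 {t} below r c out-A Q-at≡1 =
    contained-false (realised r c) out-A (t , (λ s s<t → below s s<t r c) , Q-at≡1)

  module _ (m : Fin n) (μ-vanishes : ∀ t → t F.< m → ∀ r c → μ-at t r c ≡ 0F) where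

    levels-below-vanish : LevelsVanish m
    levels-below-vanish = All.wfRec <-wellFounded 0ℓ (λ t → t F.< m → ∀ r c → Q-at t r c ≡ 0F) step
      where
      step : ∀ t → (∀ {s} → s F.< t → s F.< m → ∀ r c → Q-at s r c ≡ 0F) →
             t F.< m → ∀ r c → Q-at t r c ≡ 0F
      step t below t<m =
        grid-vanishes p>2 (Q-at t) (Q-at-additive t (μ-vanishes t t<m)) (level-bit below′) (level-≢1 below′)
        where
        below′ : LevelsVanish t
        below′ s s<t = below s<t (FinP.<-trans s<t t<m)

    corner-μ-small : X (row Fin.0F) ≡ 0V → Y (col Fin.0F) ≡ 0V → InSmall (μ-at m Fin.1F Fin.1F)
    corner-μ-small X₀≡0 Y₀≡0 = small-difference (bit-+-≤2 x₁₁ x₀₀) (bit-+-≤2 x₁₀ x₀₁) corner-equation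
      where
      x₀₀ : Bit (Q-at m Fin.0F Fin.0F)
      x₀₀ = level-bit levels-below-vanish Fin.0F Fin.0F _
      x₀₁ : Bit (Q-at m Fin.0F Fin.1F)
      x₀₁ = level-bit levels-below-vanish Fin.0F Fin.1F _
      x₁₀ : Bit (Q-at m Fin.1F Fin.0F)
      x₁₀ = level-bit levels-below-vanish Fin.1F Fin.0F _
      x₁₁ : Bit (Q-at m Fin.1F Fin.1F)
      x₁₁ = level-bit levels-below-vanish Fin.1F Fin.1F _
      μ-row₀ : ∀ c → μ-at m Fin.0F c ≡ 0F
      μ-row₀ c = trans (cong (λ u → ι 2 *F bil (M m) u (Y (col c))) X₀≡0)
                       (trans (cong (ι 2 *F_) (bil-0ˡ (M m) (Y (col c)))) (*F-zeroʳ (ι 2)))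
      μ-col₀ : ∀ r → μ-at m r Fin.0F ≡ 0F
      μ-col₀ r = trans (cong (λ v → ι 2 *F bil (M m) (X (row r)) v) Y₀≡0)
                       (trans (cong (ι 2 *F_) (bil-0ʳ (M m) (M-sym m) (X (row r)))) (*F-zeroʳ (ι 2)))
      corner-equation : ι (⟦ x₁₁ ⟧ + ⟦ x₀₀ ⟧) ≡ ι (⟦ x₁₀ ⟧ + ⟦ x₀₁ ⟧) +F μ-at m Fin.1F Fin.1F
      corner-equation = begin
        ι (⟦ x₁₁ ⟧ + ⟦ x₀₀ ⟧)
          ≡⟨ bit-+ x₁₁ x₀₀ ⟨
        Q-at m Fin.1F Fin.1F +F Q-at m Fin.0F Fin.0F
          ≡⟨ +F-drop-zeros (μ-col₀ Fin.1F) (μ-row₀ Fin.1F) (μ-row₀ Fin.0F)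
               (Q-at-rectangle m Fin.1F Fin.0F Fin.1F Fin.0F) ⟩
        (Q-at m Fin.1F Fin.0F +F Q-at m Fin.0F Fin.1F) +F μ-at m Fin.1F Fin.1F
          ≡⟨ cong (_+F μ-at m Fin.1F Fin.1F) (bit-+ x₁₀ x₀₁) ⟩
        ι (⟦ x₁₀ ⟧ + ⟦ x₀₁ ⟧) +F μ-at m Fin.1F Fin.1F
          ∎

lemma3p4 : (p : ℕ) .{{_ : NonZero p}} → Prime p → 2 < p →
    (n : ℕ) → 1 ≤ n →
    (M : Fin n → Mat {p} n) →
    (∀ t → Symmetric (M t)) →
    AllCombsFullRank M →
    (k : ℕ) → 3 ≤ k → (m : Fin n) →
    (x y : Fin k → Vec {p} n) →
    (∀ t → t F.< m → ∀ i j → μ M (withZero x) (withZero y) t i j ≡ 0F) →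
    QuadShattered (InQGS M) (withZero x) (withZero y) →
    ∀ (i j : Fin k) → InSmall (μ M (withZero x) (withZero y) m (F.suc i) (F.suc j))
lemma3p4 p _ p>2 n _ M M-sym _ k k≥3 m x y μ-vanishes shattered i j =
  subst InSmall (cong₂ (μ M X Y m) (frame-1 k≥3 i) (frame-1 k≥3 j))
    (Grid.corner-μ-small p>2 M M-sym X Y row col z realised m
      (λ t t<m r c → μ-vanishes t t<m (row r) (col c)) (cong X (frame-0 k≥3 i)) (cong Y (frame-0 k≥3 j)))
  where
  X Y : Fin (suc k) → Vec {p} n
  X = withZero x
  Y = withZero y
  row col : Fin 4 → Fin (suc k)
  row = frame k≥3 i
  col = frame k≥3 j
  φ : Fin (suc k) → Fin (suc k) → Bool
  φ I J = shape (retract row I) (retract col J)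
  z : Vec {p} n
  z = proj₁ (shattered φ)
  realised : ∀ r c → Contained (shape r c) (InQGS M ((X (row r) +V Y (col c)) +V z))
  realised = realises-restriction {A = InQGS M} {X} {Y}
    (frame-injective k≥3 i) (frame-injective k≥3 j) shape (proj₂ (shattered φ))
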